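{- Let $n\in\mathbb{N}$ and $(a_1,\ldots,a_n)\in\mathcal{A}_n$ such that $a_i<a_{i+1}$ for some $1\le i\le n-1$. Define $(a'_1,\ldots,a'_n)$ by $a'_k=a_k$ for $k\ne i,i+1$, $a'_i=a_{i+1}$ and $a'_{i+1}=a_i$. Then $(a'_1,\ldots,a'_n)\in\mathcal{A}_n$ and $c_{(a'_1,\ldots,a'_n)}>c_{(a_1,\ldots,a_n)}$.
   Context: For $n\in\mathbb{N}$ and indeterminates $x_1,\ldots,x_n$, let $p_n=x_1(x_1+x_2)\cdots(x_1+x_2+\cdots+x_n)$. Let $\mathbb{N}_0=\mathbb{N}\cup\{0\}$ and $\mathcal{A}_n=\{(a_1,\ldots,a_n)\in\mathbb{N}_0^n : \sum_{i=k+1}^n a_i\le n-k \text{ for all } 1\le k\le n-1,\ \sum_{i=1}^n a_i=n\}$. For $a\in\mathcal{A}_n$, $c_a$ denotes the coefficient of $x_1^{a_1}\cdots x_n^{a_n}$ in the expansion of $p_n$. -}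

module Defs where

open import Data.Nat using (ℕ; zero; suc; _+_; _*_; _∸_; _≤_; _<_)
open import Data.Nat.Properties using () renaming (_≟_ to _≟ℕ_)
open import Data.Fin using (Fin; toℕ)
open import Data.Vec using (Vec; []; _∷_; zipWith; replicate; tabulate; toList)
open import Data.Vec.Properties using (≡-dec)
open import Data.List as List using (List; []; _∷_; concatMap; map; drop; upTo; foldr)
open import Data.Nat.ListAction using (sum)
open import Data.Product using (_×_; _,_)
open import Relation.Nullary using (yes; no)
open import Relation.Binary.PropositionalEquality using (_≡_)

-- Polynomials in n indeterminates x₁,…,xₙ with ℕ coefficients, represented
-- as (unreduced) lists of terms  coefficient · x^e  with exponent vector e.
Monomial : ℕ → Set
Monomial n = Vec ℕ n

Poly : ℕ → Set
Poly n = List (ℕ × Monomial n)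

one : ∀ {n} → Poly n
one = (1 , replicate _ 0) ∷ []

_*P_ : ∀ {n} → Poly n → Poly n → Poly n
p *P q = concatMap (λ { (c , e) → map (λ { (d , f) → (c * d , zipWith _+_ e f) }) q }) p

-- the indeterminate x_{j+1} (0-based index j)
x : ∀ {n} → Fin n → Poly n
x {n} j = (1 , tabulate (λ l → if? (toℕ l) (toℕ j))) ∷ []
  where
  if? : ℕ → ℕ → ℕ
  if? a b with a ≟ℕ b
  ... | yes _ = 1
  ... | no _ = 0

linSum : ∀ {n} → ℕ → Poly n
linSum {n} k = concatMap (λ j → sel j) (List.allFin n)
  where
  sel : Fin n → Poly _
  sel j with Data.Nat._<?_ (toℕ j) k
  ... | yes _ = x j
  ... | no _ = []

p : (n : ℕ) → Poly n
p n = foldr (λ k acc → acc *P linSum (suc k)) one (upTo n)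

coeff : ∀ {n} → Monomial n → Poly n → ℕ
coeff a [] = 0
coeff a ((c , e) ∷ q) with ≡-dec _≟ℕ_ e a
... | yes _ = c + coeff a q
... | no _ = coeff a q

c : ∀ {n} → Vec ℕ n → ℕ
c {n} a = coeff a (p n)

-- membership in 𝒜_n (with a = (a₁,…,aₙ); drop k a = (a_{k+1},…,aₙ))
𝒜 : (n : ℕ) → Vec ℕ n → Set
𝒜 n a = ((k : ℕ) → 1 ≤ k → k < n → sum (drop k (toList a)) ≤ n ∸ k)
        × sum (toList a) ≡ n

-- a_{i+1} (0-based index i), default 0 out of range
at : ∀ {n} → ℕ → Vec ℕ n → ℕ
at i [] = 0
at zero (y ∷ ys) = y
at (suc i) (y ∷ ys) = at i ys

-- swap entries at 0-based positions i and i+1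
swapAt : ∀ {n} → ℕ → Vec ℕ n → Vec ℕ n
swapAt zero (y ∷ z ∷ r) = z ∷ y ∷ r
swapAt (suc i) (y ∷ r) = y ∷ swapAt i r
swapAt _ v = v

-- Expanding p_n = ∏ₖ (x₁ + ⋯ + x_k) gives the closed form
--   c_a = ∏ₖ binom(n - k + 1 - (a_{k+1} + ⋯ + aₙ), aₖ).
-- To see it, pass to ∏ₖ (1 + x₁ + ⋯ + x_k), whose part of degree n is p_n: there x₁ occurs in
-- every factor, so once it is decided which factors supply x₂, x₃, …, the a₁ factors supplying
-- x₁ are a free choice among the rest; induct on the variables.
-- Swapping aᵢ < aᵢ₊₁ only changes the i-th and (i+1)-th binomials, and writing them as
-- factorials shows that the product of the two gets multiplied by (K + 1 - aᵢ)/(K + 1 - aᵢ₊₁) > 1,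
-- where K = n - i - (a_{i+2} + ⋯ + aₙ). The conditions of 𝒜_n keep all binomials positive, and
-- they survive the swap because it only lowers the suffix sum starting at i + 1.
module Submission where

open import Data.Bool using (true; false; if_then_else_)
open import Data.Fin using (Fin; toℕ; zero; suc)
open import Data.List as List using (List; []; _∷_; _++_; length; upTo; applyUpTo; drop; concatMap; allFin)
open import Data.List.Properties using (length-upTo; concatMap-cong)
open import Data.Nat
open import Data.Nat.Combinatorics using (_C_; nCk≡n!/k![n-k]!; k![n∸k]!∣n!; nCk+nC[k+1]≡[n+1]C[k+1])
open import Data.Nat.DivMod using (m/n*n≡m)
open import Data.Nat.ListAction using (sum)
open import Data.Nat.Properties
open import Data.Nat.Solver using (module +-*-Solver)
open import Data.Product using (Σ; _×_; _,_; proj₁; proj₂)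
open import Data.Vec using (Vec; []; _∷_; toList; tabulate; replicate; zipWith)
open import Data.Vec.Properties using (≡-dec; tabulate-cong)
open import Function using (id; _∘_)
open import Relation.Binary.PropositionalEquality
open import Relation.Nullary using (yes; no; contradiction)
open import Relation.Nullary.Decidable using (dec-true; dec-false)

open import Defs

open import Algebra.Properties.CommutativeSemigroup +-commutativeSemigroup using ()
  renaming (interchange to +-interchange; x∙yz≈y∙xz to x+[y+z]≡y+[x+z])
open import Algebra.Properties.Semiring.Sum +-*-semiring using (sum-cong-≗; sum-replicate-zero; *-distribˡ-sum)
  renaming (sum to ∑)

open +-*-Solver using (solve; _:*_; _:=_)

private variable n : ℕ

degree : Vec ℕ n → ℕ
degree r = sum (toList r)

δ₀ : Vec ℕ n → ℕ
δ₀ []          = 1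
δ₀ (zero  ∷ r) = δ₀ r
δ₀ (suc _ ∷ r) = 0

0<degree⇒δ₀≡0 : (r : Vec ℕ n) → 0 < degree r → δ₀ r ≡ 0
0<degree⇒δ₀≡0 (zero  ∷ r) p = 0<degree⇒δ₀≡0 r p
0<degree⇒δ₀≡0 (suc _ ∷ r) p = refl

-- lowerSum K f r = ∑ f (r - eⱼ) over the positions j < K with rⱼ > 0: the coefficient
-- of x^r in F · (x₁ + ⋯ + x_K) when f is the coefficient function of F.
lowerSum : ℕ → (Vec ℕ n → ℕ) → Vec ℕ n → ℕ
lowerSum zero    f r           = 0
lowerSum (suc K) f []          = 0
lowerSum (suc K) f (zero  ∷ r) = lowerSum K (f ∘ (zero ∷_)) r
lowerSum (suc K) f (suc b ∷ r) = f (b ∷ r) + lowerSum K (f ∘ (suc b ∷_)) r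

lowerFirst : (Vec ℕ (suc n) → ℕ) → ℕ → Vec ℕ n → ℕ
lowerFirst f zero    r = 0
lowerFirst f (suc b) r = f (b ∷ r)

lowerSum-∷ : ∀ K (f : Vec ℕ (suc n) → ℕ) r₀ r →
  lowerSum (suc K) f (r₀ ∷ r) ≡ lowerFirst f r₀ r + lowerSum K (f ∘ (r₀ ∷_)) r
lowerSum-∷ K f zero    r = refl
lowerSum-∷ K f (suc b) r = refl

lowerSum-cong : ∀ K {f g : Vec ℕ n → ℕ} (r : Vec ℕ n) →
  (∀ v → suc (degree v) ≡ degree r → f v ≡ g v) → lowerSum K f r ≡ lowerSum K g r
lowerSum-cong zero    r           f≗g = refl
lowerSum-cong (suc K) []          f≗g = refl
lowerSum-cong (suc K) (zero  ∷ r) f≗g = lowerSum-cong K r (λ v → f≗g (zero ∷ v))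
lowerSum-cong (suc K) (suc b ∷ r) f≗g = cong₂ _+_ (f≗g (b ∷ r) refl)
  (lowerSum-cong K r (λ v eq → f≗g (suc b ∷ v) (trans (sym (+-suc (suc b) (degree v))) (cong (suc b +_) eq))))

lowerSum-+ : ∀ K (f g : Vec ℕ n → ℕ) r → lowerSum K (λ v → f v + g v) r ≡ lowerSum K f r + lowerSum K g r
lowerSum-+ zero    f g r           = refl
lowerSum-+ (suc K) f g []          = refl
lowerSum-+ (suc K) f g (zero  ∷ r) = lowerSum-+ K _ _ r
lowerSum-+ (suc K) f g (suc b ∷ r) =
  trans (cong (f (b ∷ r) + g (b ∷ r) +_) (lowerSum-+ K _ _ r)) (+-interchange (f (b ∷ r)) (g (b ∷ r)) _ _)

lowerSum-* : ∀ K m (f : Vec ℕ n → ℕ) r → lowerSum K (λ v → m * f v) r ≡ m * lowerSum K f r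
lowerSum-* zero    m f r           = sym (*-zeroʳ m)
lowerSum-* (suc K) m f []          = sym (*-zeroʳ m)
lowerSum-* (suc K) m f (zero  ∷ r) = lowerSum-* K m _ r
lowerSum-* (suc K) m f (suc b ∷ r) =
  trans (cong (m * f (b ∷ r) +_) (lowerSum-* K m _ r)) (sym (*-distribˡ-+ m (f (b ∷ r)) _))

lowerSum-0 : ∀ K (r : Vec ℕ n) → lowerSum K (λ _ → 0) r ≡ 0
lowerSum-0 K r = lowerSum-* K 0 (λ _ → 0) r

degree≡0⇒lowerSum≡0 : ∀ K (f : Vec ℕ n → ℕ) r → degree r ≡ 0 → lowerSum K f r ≡ 0
degree≡0⇒lowerSum≡0 zero    f r           _ = refl
degree≡0⇒lowerSum≡0 (suc K) f []          _ = refl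
degree≡0⇒lowerSum≡0 (suc K) f (zero  ∷ r) d = degree≡0⇒lowerSum≡0 K _ r d
degree≡0⇒lowerSum≡0 (suc K) f (suc b ∷ r) ()

-- The coefficient function of ∏_{k ∈ ks} (x₁ + ⋯ + x_{k+1}).
homCoeff : List ℕ → Vec ℕ n → ℕ
homCoeff []       = δ₀
homCoeff (k ∷ ks) = lowerSum (suc k) (homCoeff ks)

δℕ : ℕ → ℕ → ℕ
δℕ zero    zero    = 1
δℕ zero    (suc _) = 0
δℕ (suc _) zero    = 0
δℕ (suc a) (suc b) = δℕ a b

δℕ-refl : ∀ a → δℕ a a ≡ 1
δℕ-refl zero    = refl
δℕ-refl (suc a) = δℕ-refl a

δℕ-≢ : ∀ {a b} → a ≢ b → δℕ a b ≡ 0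
δℕ-≢ {zero}  {zero}  a≢b = contradiction refl a≢b
δℕ-≢ {zero}  {suc b} a≢b = refl
δℕ-≢ {suc a} {zero}  a≢b = refl
δℕ-≢ {suc a} {suc b} a≢b = δℕ-≢ (a≢b ∘ cong suc)

δ : Vec ℕ n → Vec ℕ n → ℕ
δ []       []       = 1
δ (e₀ ∷ e) (a₀ ∷ a) = δℕ e₀ a₀ * δ e a

δ-refl : (a : Vec ℕ n) → δ a a ≡ 1
δ-refl []       = refl
δ-refl (a₀ ∷ a) = cong₂ _*_ (δℕ-refl a₀) (δ-refl a)

δ-≢ : {e a : Vec ℕ n} → e ≢ a → δ e a ≡ 0
δ-≢ {e = []}     {[]}     e≢a = contradiction refl e≢a
δ-≢ {e = e₀ ∷ e} {a₀ ∷ a} e≢a with e₀ ≟ a₀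
... | yes refl = trans (cong (δℕ e₀ e₀ *_) (δ-≢ (e≢a ∘ cong (e₀ ∷_)))) (*-zeroʳ (δℕ e₀ e₀))
... | no e₀≢a₀ = cong (_* δ e a) (δℕ-≢ e₀≢a₀)

δ-zeros : (a : Vec ℕ n) → δ (replicate n 0) a ≡ δ₀ a
δ-zeros []          = refl
δ-zeros (zero  ∷ a) = trans (+-identityʳ _) (δ-zeros a)
δ-zeros (suc _ ∷ a) = refl

coeff-∷ : ∀ (a : Vec ℕ n) c e q → coeff a ((c , e) ∷ q) ≡ c * δ e a + coeff a q
coeff-∷ a c e q with ≡-dec _≟_ e a
... | yes refl = cong (_+ coeff a q) (sym (trans (cong (c *_) (δ-refl a)) (*-identityʳ c)))
... | no e≢a   = cong (_+ coeff a q) (sym (trans (cong (c *_) (δ-≢ e≢a)) (*-zeroʳ c)))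

coeff-++ : ∀ (a : Vec ℕ n) P Q → coeff a (P ++ Q) ≡ coeff a P + coeff a Q
coeff-++ a []            Q = refl
coeff-++ a ((c , e) ∷ P) Q = begin
  coeff a ((c , e) ∷ P ++ Q)               ≡⟨ coeff-∷ a c e (P ++ Q) ⟩
  c * δ e a + coeff a (P ++ Q)             ≡⟨ cong (c * δ e a +_) (coeff-++ a P Q) ⟩
  c * δ e a + (coeff a P + coeff a Q)      ≡⟨ +-assoc (c * δ e a) _ _ ⟨
  c * δ e a + coeff a P + coeff a Q        ≡⟨ cong (_+ coeff a Q) (coeff-∷ a c e P) ⟨
  coeff a ((c , e) ∷ P) + coeff a Q        ∎
  where open ≡-Reasoning

coeff-one : (a : Vec ℕ n) → coeff a one ≡ δ₀ a
coeff-one {n} a = trans (coeff-∷ a 1 (replicate n 0) []) (trans (+-identityʳ _) (trans (*-identityˡ _) (δ-zeros a)))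

shiftedCoeff : Vec ℕ n → Vec ℕ n → Poly n → ℕ
shiftedCoeff e a []            = 0
shiftedCoeff e a ((d , f) ∷ Q) = d * δ (zipWith _+_ e f) a + shiftedCoeff e a Q

shiftedCoeff-++ : ∀ (e a : Vec ℕ n) P Q → shiftedCoeff e a (P ++ Q) ≡ shiftedCoeff e a P + shiftedCoeff e a Q
shiftedCoeff-++ e a []            Q = refl
shiftedCoeff-++ e a ((d , f) ∷ P) Q =
  trans (cong (d * δ (zipWith _+_ e f) a +_) (shiftedCoeff-++ e a P Q)) (sym (+-assoc (d * δ (zipWith _+_ e f) a) _ _))

coeff-map-term : ∀ (a : Vec ℕ n) c e (g : ℕ × Monomial n → ℕ × Monomial n) →
  (∀ d f → g (d , f) ≡ (c * d , zipWith _+_ e f)) → ∀ Q → coeff a (List.map g Q) ≡ c * shiftedCoeff e a Q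
coeff-map-term a c e g g≡ []            = sym (*-zeroʳ c)
coeff-map-term a c e g g≡ ((d , f) ∷ Q) rewrite g≡ d f = begin
  coeff a ((c * d , zipWith _+_ e f) ∷ List.map g Q)                  ≡⟨ coeff-∷ a (c * d) (zipWith _+_ e f) (List.map g Q) ⟩
  c * d * δ (zipWith _+_ e f) a + coeff a (List.map g Q)              ≡⟨ cong₂ _+_ (*-assoc c d _) (coeff-map-term a c e g g≡ Q) ⟩
  c * (d * δ (zipWith _+_ e f) a) + c * shiftedCoeff e a Q            ≡⟨ *-distribˡ-+ c _ _ ⟨
  c * shiftedCoeff e a ((d , f) ∷ Q)                                  ∎
  where open ≡-Reasoning

-- Pattern lambdas and local helpers of Defs cannot be referred to by name; proving such a
-- Σ-type by `_ , refl` lets unification name them (also in x-indicator and linSum-selector).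
*P-∷ : ∀ c e (P Q : Poly n) → Σ (ℕ × Monomial n → ℕ × Monomial n) λ g →
  (∀ d f → g (d , f) ≡ (c * d , zipWith _+_ e f)) × (((c , e) ∷ P) *P Q ≡ List.map g Q ++ P *P Q)
*P-∷ c e P Q = _ , (λ d f → refl) , refl

coeff-*P-∷ : ∀ (a : Vec ℕ n) c e P Q → coeff a (((c , e) ∷ P) *P Q) ≡ c * shiftedCoeff e a Q + coeff a (P *P Q)
coeff-*P-∷ a c e P Q with *P-∷ c e P Q
... | g , g≡ , *P≡ = begin
  coeff a (((c , e) ∷ P) *P Q)                  ≡⟨ cong (coeff a) *P≡ ⟩
  coeff a (List.map g Q ++ P *P Q)              ≡⟨ coeff-++ a (List.map g Q) (P *P Q) ⟩
  coeff a (List.map g Q) + coeff a (P *P Q)     ≡⟨ cong (_+ coeff a (P *P Q)) (coeff-map-term a c e g g≡ Q) ⟩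
  c * shiftedCoeff e a Q + coeff a (P *P Q)     ∎
  where open ≡-Reasoning

unit : Fin n → Vec ℕ n
unit j = tabulate (λ l → δℕ (toℕ l) (toℕ j))

x-indicator : (j : Fin n) → Σ (Fin n → ℕ) λ f → x j ≡ (1 , tabulate f) ∷ []
x-indicator j = _ , refl

linSum-selector : ∀ K → Σ (Fin n → Poly n) λ s → linSum K ≡ concatMap s (allFin n)
linSum-selector K = _ , refl

x-indicator≡δℕ : (j l : Fin n) → proj₁ (x-indicator j) l ≡ δℕ (toℕ l) (toℕ j)
x-indicator≡δℕ j l with toℕ l ≟ toℕ j
... | yes l≡j = trans (sym (δℕ-refl (toℕ l))) (cong (δℕ (toℕ l)) l≡j)
... | no  l≢j = sym (δℕ-≢ l≢j)

x≡unit : (j : Fin n) → x j ≡ (1 , unit j) ∷ []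
x≡unit j = trans (proj₂ (x-indicator j))
  (cong (λ e → (1 , e) ∷ []) (tabulate-cong (x-indicator≡δℕ j)))

linSumTerm : ℕ → Fin n → Poly n
linSumTerm K j = if toℕ j <ᵇ K then (1 , unit j) ∷ [] else []

linSum-selector≡linSumTerm : ∀ K (j : Fin n) → proj₁ (linSum-selector K) j ≡ linSumTerm K j
linSum-selector≡linSumTerm K j with toℕ j <? K
... | yes j<K = trans (x≡unit j) (cong (λ b → if b then (1 , unit j) ∷ [] else []) (sym (dec-true (toℕ j <? K) j<K)))
... | no  j≮K = cong (λ b → if b then (1 , unit j) ∷ [] else []) (sym (dec-false (toℕ j <? K) j≮K))

linSum≡concatMap : ∀ K → linSum {n} K ≡ concatMap (linSumTerm K) (allFin n)
linSum≡concatMap {n} K = trans (proj₂ (linSum-selector K)) (concatMap-cong (linSum-selector≡linSumTerm K) (allFin n))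

shiftedCoeff-concatMap : ∀ {m} (e a : Vec ℕ n) (s : Fin n → Poly n) (f : Fin m → Fin n) →
  shiftedCoeff e a (concatMap s (List.tabulate f)) ≡ ∑ (λ i → shiftedCoeff e a (s (f i)))
shiftedCoeff-concatMap {m = zero}  e a s f = refl
shiftedCoeff-concatMap {m = suc m} e a s f =
  trans (shiftedCoeff-++ e a (s (f zero)) _) (cong (shiftedCoeff e a (s (f zero)) +_) (shiftedCoeff-concatMap e a s (f ∘ suc)))

shiftedCoeff-linSumTerm : ∀ K (e a : Vec ℕ n) j →
  shiftedCoeff e a (linSumTerm K j) ≡ (if toℕ j <ᵇ K then δ (zipWith _+_ e (unit j)) a else 0)
shiftedCoeff-linSumTerm K e a j with toℕ j <ᵇ K
... | true  = trans (+-identityʳ _) (*-identityˡ _)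
... | false = refl

if-then-* : ∀ b m t → (if b then m * t else 0) ≡ m * (if b then t else 0)
if-then-* true  m t = refl
if-then-* false m t = sym (*-zeroʳ m)

zipWith-+-zeros : (e : Vec ℕ n) → zipWith _+_ e (tabulate (λ _ → 0)) ≡ e
zipWith-+-zeros []       = refl
zipWith-+-zeros (e₀ ∷ e) = cong₂ _∷_ (+-identityʳ e₀) (zipWith-+-zeros e)

δℕ-suc-lowerFirst : ∀ e₀ a₀ (e a : Vec ℕ n) → δℕ (suc e₀) a₀ * δ e a ≡ lowerFirst (δ (e₀ ∷ e)) a₀ a
δℕ-suc-lowerFirst e₀ zero    e a = refl
δℕ-suc-lowerFirst e₀ (suc b) e a = refl

∑-shiftedUnits : ∀ K (e a : Vec ℕ n) →
  ∑ (λ j → if toℕ j <ᵇ K then δ (zipWith _+_ e (unit j)) a else 0) ≡ lowerSum K (δ e) a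
∑-shiftedUnits zero    []       []       = refl
∑-shiftedUnits (suc K) []       []       = refl
∑-shiftedUnits {suc n} zero (_ ∷ _) (_ ∷ _) = sum-replicate-zero (suc n)
∑-shiftedUnits (suc K) (e₀ ∷ e) (a₀ ∷ a) =
  trans (cong₂ _+_ first rest) (sym (lowerSum-∷ K (δ (e₀ ∷ e)) a₀ a))
  where
  first : δℕ (e₀ + 1) a₀ * δ (zipWith _+_ e (tabulate (λ _ → 0))) a ≡ lowerFirst (δ (e₀ ∷ e)) a₀ a
  first rewrite +-comm e₀ 1 | zipWith-+-zeros e = δℕ-suc-lowerFirst e₀ a₀ e a
  t : Fin _ → ℕ
  t j = δ (zipWith _+_ e (unit j)) a
  rest : ∑ (λ j → if toℕ j <ᵇ K then δℕ (e₀ + 0) a₀ * t j else 0) ≡ lowerSum K (λ v → δℕ e₀ a₀ * δ e v) a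
  rest = begin
    ∑ (λ j → if toℕ j <ᵇ K then δℕ (e₀ + 0) a₀ * t j else 0)
      ≡⟨ sum-cong-≗ (λ j → trans (cong (λ e₀′ → if toℕ j <ᵇ K then δℕ e₀′ a₀ * t j else 0) (+-identityʳ e₀))
                                 (if-then-* (toℕ j <ᵇ K) (δℕ e₀ a₀) (t j))) ⟩
    ∑ (λ j → δℕ e₀ a₀ * (if toℕ j <ᵇ K then t j else 0))
      ≡⟨ *-distribˡ-sum (δℕ e₀ a₀) (λ j → if toℕ j <ᵇ K then t j else 0) ⟨
    δℕ e₀ a₀ * ∑ (λ j → if toℕ j <ᵇ K then t j else 0)
      ≡⟨ cong (δℕ e₀ a₀ *_) (∑-shiftedUnits K e a) ⟩
    δℕ e₀ a₀ * lowerSum K (δ e) a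
      ≡⟨ lowerSum-* K (δℕ e₀ a₀) (δ e) a ⟨
    lowerSum K (λ v → δℕ e₀ a₀ * δ e v) a ∎
    where open ≡-Reasoning

shiftedCoeff-linSum : ∀ K (e a : Vec ℕ n) → shiftedCoeff e a (linSum K) ≡ lowerSum K (δ e) a
shiftedCoeff-linSum {n} K e a = begin
  shiftedCoeff e a (linSum K)                                                   ≡⟨ cong (shiftedCoeff e a) (linSum≡concatMap K) ⟩
  shiftedCoeff e a (concatMap (linSumTerm K) (allFin n))                        ≡⟨ shiftedCoeff-concatMap e a (linSumTerm K) id ⟩
  ∑ (λ j → shiftedCoeff e a (linSumTerm K j))                                   ≡⟨ sum-cong-≗ (shiftedCoeff-linSumTerm K e a) ⟩
  ∑ (λ j → if toℕ j <ᵇ K then δ (zipWith _+_ e (unit j)) a else 0)            ≡⟨ ∑-shiftedUnits K e a ⟩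
  lowerSum K (δ e) a                                                            ∎
  where open ≡-Reasoning

coeff-*P-linSum : ∀ (P : Poly n) K a → coeff a (P *P linSum K) ≡ lowerSum K (λ r → coeff r P) a
coeff-*P-linSum []            K a = sym (lowerSum-0 K a)
coeff-*P-linSum ((c , e) ∷ P) K a = begin
  coeff a (((c , e) ∷ P) *P linSum K)                                      ≡⟨ coeff-*P-∷ a c e P (linSum K) ⟩
  c * shiftedCoeff e a (linSum K) + coeff a (P *P linSum K)                ≡⟨ cong₂ (λ t u → c * t + u) (shiftedCoeff-linSum K e a) (coeff-*P-linSum P K a) ⟩
  c * lowerSum K (δ e) a + lowerSum K (λ r → coeff r P) a                  ≡⟨ cong (_+ lowerSum K (λ r → coeff r P) a) (lowerSum-* K c (δ e) a) ⟨
  lowerSum K (λ r → c * δ e r) a + lowerSum K (λ r → coeff r P) a          ≡⟨ lowerSum-+ K (λ r → c * δ e r) (λ r → coeff r P) a ⟨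
  lowerSum K (λ r → c * δ e r + coeff r P) a                               ≡⟨ lowerSum-cong K a (λ r _ → coeff-∷ r c e P) ⟨
  lowerSum K (λ r → coeff r ((c , e) ∷ P)) a                               ∎
  where open ≡-Reasoning

coeff-product : ∀ ks (a : Vec ℕ n) → coeff a (List.foldr (λ k acc → acc *P linSum (suc k)) one ks) ≡ homCoeff ks a
coeff-product []       a = coeff-one a
coeff-product (k ∷ ks) a =
  trans (coeff-*P-linSum (List.foldr (λ k acc → acc *P linSum (suc k)) one ks) (suc k) a)
        (lowerSum-cong (suc k) a (λ r _ → coeff-product ks r))

-- The coefficient function of ∏_{k ∈ ks} (1 + x₁ + ⋯ + x_{k+1}).
inhomCoeff : List ℕ → Vec ℕ n → ℕ
inhomCoeff []       r = δ₀ r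
inhomCoeff (k ∷ ks) r = inhomCoeff ks r + lowerSum (suc k) (inhomCoeff ks) r

length<degree⇒inhomCoeff≡0 : ∀ ks (r : Vec ℕ n) → length ks < degree r → inhomCoeff ks r ≡ 0
length<degree⇒inhomCoeff≡0 []       r p = 0<degree⇒δ₀≡0 r p
length<degree⇒inhomCoeff≡0 (k ∷ ks) r p = cong₂ _+_
  (length<degree⇒inhomCoeff≡0 ks r (<-trans (n<1+n _) p))
  (trans (lowerSum-cong (suc k) r (λ v eq → length<degree⇒inhomCoeff≡0 ks v (s<s⁻¹ (subst (suc (length ks) <_) (sym eq) p))))
         (lowerSum-0 (suc k) r))

homCoeff≡inhomCoeff : ∀ ks (r : Vec ℕ n) → degree r ≡ length ks → homCoeff ks r ≡ inhomCoeff ks r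
homCoeff≡inhomCoeff []       r eq = refl
homCoeff≡inhomCoeff (k ∷ ks) r eq = begin
  lowerSum (suc k) (homCoeff ks) r                         ≡⟨ lowerSum-cong (suc k) r (λ v eq′ → homCoeff≡inhomCoeff ks v (suc-injective (trans eq′ eq))) ⟩
  lowerSum (suc k) (inhomCoeff ks) r                       ≡⟨ cong (_+ lowerSum (suc k) (inhomCoeff ks) r) (length<degree⇒inhomCoeff≡0 ks r (subst (length ks <_) (sym eq) (n<1+n _))) ⟨
  inhomCoeff ks r + lowerSum (suc k) (inhomCoeff ks) r    ∎
  where open ≡-Reasoning

C*factorials≡! : ∀ k m → ((k + m) C k) * (k ! * m !) ≡ (k + m) !
C*factorials≡! k m = begin
  ((k + m) C k) * (k ! * m !)                   ≡⟨ cong (λ d → ((k + m) C k) * (k ! * d !)) (m+n∸m≡n k m) ⟨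
  ((k + m) C k) * (k ! * (k + m ∸ k) !)         ≡⟨ cong (_* (k ! * (k + m ∸ k) !)) (nCk≡n!/k![n-k]! k≤k+m) ⟩
  (k + m) ! / (k ! * (k + m ∸ k) !) * _       ≡⟨ m/n*n≡m (k![n∸k]!∣n! k≤k+m) ⟩
  (k + m) !                                   ∎
  where
  open ≡-Reasoning
  k≤k+m = m≤m+n k m
  instance _ = k !* (k + m ∸ k) !≢0

0<C : ∀ {m k} → k ≤ m → 0 < m C k
0<C {m} {k} k≤m = n≢0⇒n>0 λ C≡0 → ≢-nonZero⁻¹ (m !) {{m !≢0}} (begin
  m !                                  ≡⟨ cong _! (m+[n∸m]≡n k≤m) ⟨
  (k + (m ∸ k)) !                      ≡⟨ C*factorials≡! k (m ∸ k) ⟨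
  ((k + (m ∸ k)) C k) * (k ! * (m ∸ k) !) ≡⟨ cong (λ l → (l C k) * (k ! * (m ∸ k) !)) (m+[n∸m]≡n k≤m) ⟩
  (m C k) * (k ! * (m ∸ k) !)             ≡⟨ cong (_* (k ! * (m ∸ k) !)) C≡0 ⟩
  0                                     ∎)
  where open ≡-Reasoning

C-pascal-∸ : ∀ M s b Z → (M < s → Z ≡ 0) →
  ((M ∸ s) C suc b) * Z + ((M ∸ s) C b) * Z ≡ ((suc M ∸ s) C suc b) * Z
C-pascal-∸ M s b Z Z≡0 with s ≤? M
... | yes s≤M = begin
  ((M ∸ s) C suc b) * Z + ((M ∸ s) C b) * Z   ≡⟨ +-comm (((M ∸ s) C suc b) * Z) _ ⟩
  ((M ∸ s) C b) * Z + ((M ∸ s) C suc b) * Z   ≡⟨ *-distribʳ-+ Z ((M ∸ s) C b) _ ⟨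
  ((M ∸ s) C b + (M ∸ s) C suc b) * Z         ≡⟨ cong (_* Z) (nCk+nC[k+1]≡[n+1]C[k+1] (M ∸ s) b) ⟩
  (suc (M ∸ s) C suc b) * Z                   ≡⟨ cong (λ l → (l C suc b) * Z) (+-∸-assoc 1 s≤M) ⟨
  ((suc M ∸ s) C suc b) * Z                   ∎
  where open ≡-Reasoning
... | no s≰M rewrite Z≡0 (≰⇒> s≰M) | *-zeroʳ ((M ∸ s) C suc b) | *-zeroʳ ((M ∸ s) C b) =
  sym (*-zeroʳ ((suc M ∸ s) C suc b))

C-exchange : ∀ {x y u v d} → x + u ≡ y + v → x + d ≡ suc v → y + d ≡ suc u →
  ((x + d) C x) * ((y + v) C y) * suc u ≡ ((y + d) C y) * ((x + u) C x) * suc v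
C-exchange {x} {y} {u} {v} {d} x+u≡y+v x+d≡1+v y+d≡1+u = *-cancelʳ-≡ _ _ W {{W≢0}} (begin
  ((x + d) C x) * ((y + v) C y) * suc u * W
    ≡⟨ solve 8 (λ a b s xf yf df uf vf → a :* b :* s :* (xf :* yf :* df :* uf :* vf)
                 := a :* (xf :* df) :* (b :* (yf :* vf)) :* (s :* uf)) refl ((x + d) C x) ((y + v) C y) (suc u) (x !) (y !) (d !) (u !) (v !) ⟩
  ((x + d) C x) * (x ! * d !) * (((y + v) C y) * (y ! * v !)) * suc u !
    ≡⟨ cong₂ (λ a b → a * b * suc u !) (C*factorials≡! x d) (C*factorials≡! y v) ⟩
  (x + d) ! * (y + v) ! * suc u !
    ≡⟨ cong₂ (λ a b → a ! * b ! * suc u !) x+d≡1+v (sym x+u≡y+v) ⟩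
  suc v ! * (x + u) ! * suc u !
    ≡⟨ solve 3 (λ a b c → a :* b :* c := c :* b :* a) refl (suc v !) ((x + u) !) (suc u !) ⟩
  suc u ! * (x + u) ! * suc v !
    ≡⟨ cong (λ a → a ! * (x + u) ! * suc v !) y+d≡1+u ⟨
  (y + d) ! * (x + u) ! * suc v !
    ≡⟨ cong₂ (λ a b → a * b * suc v !) (C*factorials≡! y d) (C*factorials≡! x u) ⟨
  ((y + d) C y) * (y ! * d !) * (((x + u) C x) * (x ! * u !)) * suc v !
    ≡⟨ solve 8 (λ a b s xf yf df uf vf → a :* (yf :* df) :* (b :* (xf :* uf)) :* (s :* vf)
                 := a :* b :* s :* (xf :* yf :* df :* uf :* vf)) refl ((y + d) C y) ((x + u) C x) (suc v) (x !) (y !) (d !) (u !) (v !) ⟩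
  ((y + d) C y) * ((x + u) C x) * suc v * W ∎)
  where
  open ≡-Reasoning
  W = x ! * y ! * d ! * u ! * v !
  W≢0 : NonZero W
  W≢0 = m*n≢0 _ _ {{m*n≢0 _ _ {{m*n≢0 _ _ {{x !* y !≢0}} {{d !≢0}}}} {{u !≢0}}}} {{v !≢0}}

C-exchange-< : ∀ {K x y} → x < y → y ≤ K → x + y ≤ suc K →
  ((suc K ∸ y) C x) * (K C y) < ((suc K ∸ x) C y) * (K C x)
C-exchange-< {K} {x} {y} x<y y≤K x+y≤1+K =
  subst₂ _<_ (cong₂ (λ a b → (a C x) * (b C y)) (sym 1+K∸y≡x+d) y+v≡K)
             (cong₂ (λ a b → (a C y) * (b C x)) (sym 1+K∸x≡y+d) x+u≡K)
    (*-cancelʳ-< (suc u) _ _ (subst (_< ((y + d) C y) * ((x + u) C x) * suc u) (sym exchange)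
      (*-monoʳ-< (((y + d) C y) * ((x + u) C x)) {{>-nonZero 0<A′B′}} (s<s (∸-monoʳ-< x<y y≤K)))))
  where
  x≤K = <⇒≤ (<-≤-trans x<y y≤K)
  u = K ∸ x
  v = K ∸ y
  d = suc K ∸ (x + y)
  x+u≡K : x + u ≡ K
  x+u≡K = m+[n∸m]≡n x≤K
  y+v≡K : y + v ≡ K
  y+v≡K = m+[n∸m]≡n y≤K
  a+[1+K∸[a+b]]≡1+K∸b : ∀ a b → a + b ≤ suc K → a + (suc K ∸ (a + b)) ≡ suc K ∸ b
  a+[1+K∸[a+b]]≡1+K∸b a b a+b≤ = trans (sym (+-∸-assoc a a+b≤)) ([m+n]∸[m+o]≡n∸o a (suc K) b)
  1+K∸y≡x+d : suc K ∸ y ≡ x + d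
  1+K∸y≡x+d = sym (a+[1+K∸[a+b]]≡1+K∸b x y x+y≤1+K)
  1+K∸x≡y+d : suc K ∸ x ≡ y + d
  1+K∸x≡y+d = trans (sym (a+[1+K∸[a+b]]≡1+K∸b y x (subst (_≤ suc K) (+-comm x y) x+y≤1+K)))
                    (cong (λ e → y + (suc K ∸ e)) (+-comm y x))
  exchange : ((x + d) C x) * ((y + v) C y) * suc u ≡ ((y + d) C y) * ((x + u) C x) * suc v
  exchange = C-exchange (trans x+u≡K (sym y+v≡K))
    (trans (sym 1+K∸y≡x+d) (+-∸-assoc 1 y≤K)) (trans (sym 1+K∸x≡y+d) (+-∸-assoc 1 x≤K))
  0<A′B′ : 0 < ((y + d) C y) * ((x + u) C x)
  0<A′B′ = *-mono-< (0<C (m≤m+n y d)) (0<C (m≤m+n x u))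

-- Setting x₁ = 0 turns ∏_{k ∈ ks} (1 + x₁ + ⋯ + x_{k+1}) into
-- ∏_{k ∈ tailFactors ks} (1 + x₂ + ⋯ + x_{k+2}).
tailFactors : List ℕ → List ℕ
tailFactors []           = []
tailFactors (zero  ∷ ks) = tailFactors ks
tailFactors (suc k ∷ ks) = k ∷ tailFactors ks

length-tailFactors : ∀ ks → length (tailFactors ks) ≤ length ks
length-tailFactors []           = z≤n
length-tailFactors (zero  ∷ ks) = m≤n⇒m≤1+n (length-tailFactors ks)
length-tailFactors (suc k ∷ ks) = s≤s (length-tailFactors ks)

inhomCoeff-tailFactors-∷ : ∀ k ks (r : Vec ℕ n) →
  inhomCoeff (tailFactors (k ∷ ks)) r ≡ inhomCoeff (tailFactors ks) r + lowerSum k (inhomCoeff (tailFactors ks)) r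
inhomCoeff-tailFactors-∷ zero    ks r = sym (+-identityʳ _)
inhomCoeff-tailFactors-∷ (suc k) ks r = refl

-- Of the length ks factors, those not supplying one of the degree r variables x₂, x₃, … supply
-- 1 or x₁ freely.
inhomCoeff-∷ : ∀ ks r₀ (r : Vec ℕ n) →
  inhomCoeff ks (r₀ ∷ r) ≡ ((length ks ∸ degree r) C r₀) * inhomCoeff (tailFactors ks) r
inhomCoeff-∷ []       zero    r = sym (+-identityʳ _)
inhomCoeff-∷ []       (suc b) r rewrite 0∸n≡0 (degree r) = refl
inhomCoeff-∷ (k ∷ ks) r₀      r = begin
  E (r₀ ∷ r) + lowerSum (suc k) E (r₀ ∷ r)                           ≡⟨ cong (E (r₀ ∷ r) +_) (lowerSum-∷ k E r₀ r) ⟩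
  E (r₀ ∷ r) + (lowerFirst E r₀ r + lowerSum k (E ∘ (r₀ ∷_)) r)      ≡⟨ +-assoc (E (r₀ ∷ r)) _ _ ⟨
  E (r₀ ∷ r) + lowerFirst E r₀ r + lowerSum k (E ∘ (r₀ ∷_)) r        ≡⟨ cong₂ _+_ (first r₀) rest ⟩
  B r₀ * Z + B r₀ * lowerSum k E′ r                                   ≡⟨ *-distribˡ-+ (B r₀) Z _ ⟨
  B r₀ * (Z + lowerSum k E′ r)                                        ≡⟨ cong (B r₀ *_) (inhomCoeff-tailFactors-∷ k ks r) ⟨
  B r₀ * inhomCoeff (tailFactors (k ∷ ks)) r                          ∎
  where
  open ≡-Reasoning
  M = length ks
  E = inhomCoeff ks
  E′ = inhomCoeff (tailFactors ks)
  Z = E′ r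
  B : ℕ → ℕ
  B l = (suc M ∸ degree r) C l
  Z≡0 : M < degree r → Z ≡ 0
  Z≡0 M<s = length<degree⇒inhomCoeff≡0 (tailFactors ks) r (≤-<-trans (length-tailFactors ks) M<s)
  first : ∀ r₀ → E (r₀ ∷ r) + lowerFirst E r₀ r ≡ B r₀ * Z
  first zero    = trans (+-identityʳ _) (inhomCoeff-∷ ks zero r)
  first (suc b) rewrite inhomCoeff-∷ ks (suc b) r | inhomCoeff-∷ ks b r = C-pascal-∸ M (degree r) b Z Z≡0
  rest : lowerSum k (E ∘ (r₀ ∷_)) r ≡ B r₀ * lowerSum k E′ r
  rest with degree r in eq
  ... | zero  = trans (degree≡0⇒lowerSum≡0 k _ r eq)
    (sym (trans (cong ((suc M C r₀) *_) (degree≡0⇒lowerSum≡0 k E′ r eq)) (*-zeroʳ (suc M C r₀))))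
  ... | suc t = trans
    (lowerSum-cong k r λ v eq′ →
      trans (inhomCoeff-∷ ks r₀ v) (cong (λ s → ((M ∸ s) C r₀) * E′ v) (suc-injective (trans eq′ eq))))
    (lowerSum-* k ((M ∸ t) C r₀) E′ r)

binomialProduct : ℕ → Vec ℕ n → ℕ
binomialProduct m []       = 1
binomialProduct m (r₀ ∷ r) = ((m ∸ degree r) C r₀) * binomialProduct (pred m) r

tailFactors-applyUpTo : ∀ (f : ℕ → ℕ) m → tailFactors (applyUpTo (suc ∘ f) m) ≡ applyUpTo f m
tailFactors-applyUpTo f zero    = refl
tailFactors-applyUpTo f (suc m) = cong (f 0 ∷_) (tailFactors-applyUpTo (f ∘ suc) m)

tailFactors-upTo : ∀ m → tailFactors (upTo m) ≡ upTo (pred m)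
tailFactors-upTo zero    = refl
tailFactors-upTo (suc m) = tailFactors-applyUpTo id m

inhomCoeff-[] : ∀ ks → inhomCoeff ks [] ≡ 1
inhomCoeff-[] []       = refl
inhomCoeff-[] (k ∷ ks) = trans (+-identityʳ _) (inhomCoeff-[] ks)

inhomCoeff-upTo : ∀ m (r : Vec ℕ n) → inhomCoeff (upTo m) r ≡ binomialProduct m r
inhomCoeff-upTo m []       = inhomCoeff-[] (upTo m)
inhomCoeff-upTo m (r₀ ∷ r) = begin
  inhomCoeff (upTo m) (r₀ ∷ r)                                                   ≡⟨ inhomCoeff-∷ (upTo m) r₀ r ⟩
  ((length (upTo m) ∸ degree r) C r₀) * inhomCoeff (tailFactors (upTo m)) r    ≡⟨ cong₂ (λ l ks → ((l ∸ degree r) C r₀) * inhomCoeff ks r) (length-upTo m) (tailFactors-upTo m) ⟩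
  ((m ∸ degree r) C r₀) * inhomCoeff (upTo (pred m)) r                         ≡⟨ cong (((m ∸ degree r) C r₀) *_) (inhomCoeff-upTo (pred m) r) ⟩
  binomialProduct m (r₀ ∷ r)                                                     ∎
  where open ≡-Reasoning

c≡binomialProduct : (a : Vec ℕ n) → degree a ≡ n → c a ≡ binomialProduct n a
c≡binomialProduct {n} a degree≡n = begin
  c a                               ≡⟨ coeff-product (upTo n) a ⟩
  homCoeff (upTo n) a               ≡⟨ homCoeff≡inhomCoeff (upTo n) a (trans degree≡n (sym (length-upTo n))) ⟩
  inhomCoeff (upTo n) a             ≡⟨ inhomCoeff-upTo n a ⟩
  binomialProduct n a               ∎
  where open ≡-Reasoning

TailBounded : ℕ → Vec ℕ n → Set
TailBounded m r = ∀ j → sum (drop j (toList r)) ≤ m ∸ j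

TailBounded-tail : ∀ {m r₀} {r : Vec ℕ n} → TailBounded m (r₀ ∷ r) → TailBounded (pred m) r
TailBounded-tail {m = m} {r = r} bounded j =
  subst (sum (drop j (toList r)) ≤_) (sym (∸-+-assoc m 1 j)) (bounded (suc j))

TailBounded-head : ∀ {m r₀} {r : Vec ℕ n} → TailBounded m (r₀ ∷ r) → r₀ ≤ m ∸ degree r
TailBounded-head {m = m} {r₀} {r} bounded =
  subst (_≤ m ∸ degree r) (m+n∸n≡m r₀ (degree r)) (∸-monoˡ-≤ (degree r) (bounded 0))

0<binomialProduct : ∀ {m} (r : Vec ℕ n) → TailBounded m r → 0 < binomialProduct m r
0<binomialProduct []       bounded = z<s
0<binomialProduct (r₀ ∷ r) bounded =
  *-mono-< (0<C (TailBounded-head bounded)) (0<binomialProduct r (TailBounded-tail bounded))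

degree-swapAt : ∀ i (r : Vec ℕ n) → degree (swapAt i r) ≡ degree r
degree-swapAt zero    []            = refl
degree-swapAt zero    (y ∷ [])      = refl
degree-swapAt zero    (y ∷ z ∷ r)   = x+[y+z]≡y+[x+z] z y (degree r)
degree-swapAt (suc i) []            = refl
degree-swapAt (suc i) (y ∷ r)       = cong (y +_) (degree-swapAt i r)

adjacentFactors-< : ∀ {m T x y} → x < y → y + T ≤ pred m → x + (y + T) ≤ m →
  ((m ∸ (y + T)) C x) * ((pred m ∸ T) C y) < ((m ∸ (x + T)) C y) * ((pred m ∸ T) C x)
adjacentFactors-< {zero}   {T} {x} {suc y} x<y () _
adjacentFactors-< {suc m′} {T} {x} {y}     x<y y+T≤m′ x+[y+T]≤m =
  subst₂ _<_ (cong (λ a → (a C x) * ((m′ ∸ T) C y)) (sym (∸-shift y)))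
             (cong (λ a → (a C y) * ((m′ ∸ T) C x)) (sym (∸-shift x)))
    (C-exchange-< x<y (m+n≤o⇒m≤o∸n y y+T≤m′)
      (subst (x + y ≤_) (+-∸-assoc 1 T≤m′) (m+n≤o⇒m≤o∸n (x + y) (subst (_≤ suc m′) (sym (+-assoc x y T)) x+[y+T]≤m))))
  where
  T≤m′ : T ≤ m′
  T≤m′ = m+n≤o⇒n≤o y y+T≤m′
  ∸-shift : ∀ z → suc m′ ∸ (z + T) ≡ suc (m′ ∸ T) ∸ z
  ∸-shift z = begin
    suc m′ ∸ (z + T)     ≡⟨ cong (suc m′ ∸_) (+-comm z T) ⟩
    suc m′ ∸ (T + z)     ≡⟨ ∸-+-assoc (suc m′) T z ⟨
    suc m′ ∸ T ∸ z       ≡⟨ cong (_∸ z) (+-∸-assoc 1 T≤m′) ⟩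
    suc (m′ ∸ T) ∸ z     ∎
    where open ≡-Reasoning

binomialProduct-swapAt : ∀ {m} i (r : Vec ℕ n) → TailBounded m r → at i r < at (suc i) r →
  binomialProduct m r < binomialProduct m (swapAt i r)
binomialProduct-swapAt {m = m} zero (x ∷ y ∷ r) bounded x<y = begin-strict
  ((m ∸ (y + T)) C x) * (((pred m ∸ T) C y) * G)   ≡⟨ *-assoc ((m ∸ (y + T)) C x) _ G ⟨
  ((m ∸ (y + T)) C x) * ((pred m ∸ T) C y) * G     <⟨ *-monoˡ-< G {{>-nonZero (0<binomialProduct r (TailBounded-tail (TailBounded-tail bounded)))}}
                                                          (adjacentFactors-< x<y (TailBounded-tail bounded 0) (bounded 0)) ⟩
  ((m ∸ (x + T)) C y) * ((pred m ∸ T) C x) * G     ≡⟨ *-assoc ((m ∸ (x + T)) C y) _ G ⟩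
  ((m ∸ (x + T)) C y) * (((pred m ∸ T) C x) * G)   ∎
  where
  open ≤-Reasoning
  T = degree r
  G = binomialProduct (pred (pred m)) r
binomialProduct-swapAt {m = m} (suc i) (r₀ ∷ r) bounded lt rewrite degree-swapAt i r =
  *-monoʳ-< ((m ∸ degree r) C r₀) {{>-nonZero (0<C (TailBounded-head bounded))}}
    (binomialProduct-swapAt i r (TailBounded-tail bounded) lt)

suffixSum-swapAt-≤ : ∀ i (r : Vec ℕ n) → at i r ≤ at (suc i) r →
  ∀ k → sum (drop k (toList (swapAt i r))) ≤ sum (drop k (toList r))
suffixSum-swapAt-≤ zero    []          y≤z k             = ≤-refl
suffixSum-swapAt-≤ zero    (y ∷ [])    y≤z k             = ≤-refl
suffixSum-swapAt-≤ zero    (y ∷ z ∷ r) y≤z zero          = ≤-reflexive (degree-swapAt zero (y ∷ z ∷ r))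
suffixSum-swapAt-≤ zero    (y ∷ z ∷ r) y≤z (suc zero)    = +-monoˡ-≤ (degree r) y≤z
suffixSum-swapAt-≤ zero    (y ∷ z ∷ r) y≤z (suc (suc k)) = ≤-refl
suffixSum-swapAt-≤ (suc i) []          le  k             = ≤-refl
suffixSum-swapAt-≤ (suc i) (y ∷ r)     le  zero          = ≤-reflexive (degree-swapAt (suc i) (y ∷ r))
suffixSum-swapAt-≤ (suc i) (y ∷ r)     le  (suc k)       = suffixSum-swapAt-≤ i r le k

suffixSum-beyond : ∀ (r : Vec ℕ n) j → n ≤ j → sum (drop j (toList r)) ≡ 0
suffixSum-beyond []      zero    _         = refl
suffixSum-beyond []      (suc j) _         = refl
suffixSum-beyond (_ ∷ r) (suc j) (s≤s n≤j) = suffixSum-beyond r j n≤j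

𝒜⇒TailBounded : ∀ {n} (a : Vec ℕ n) → 𝒜 n a → TailBounded n a
𝒜⇒TailBounded {n} a (bounded , total) zero    = ≤-reflexive total
𝒜⇒TailBounded {n} a (bounded , total) (suc j) with suc j <? n
... | yes j<n = bounded (suc j) (s≤s z≤n) j<n
... | no  j≮n = subst (_≤ n ∸ suc j) (sym (suffixSum-beyond a (suc j) (≮⇒≥ j≮n))) z≤n

𝒜-swapAt : ∀ {n} i (a : Vec ℕ n) → at i a ≤ at (suc i) a → 𝒜 n a → 𝒜 n (swapAt i a)
𝒜-swapAt i a le (bounded , total) =
  (λ k 1≤k k<n → ≤-trans (suffixSum-swapAt-≤ i a le k) (bounded k 1≤k k<n)) , trans (degree-swapAt i a) total

lemma9 : (n : ℕ) (a : Vec ℕ n) → 𝒜 n a → (i : ℕ) → suc i < n →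
    at i a < at (suc i) a →
    𝒜 n (swapAt i a) × c (swapAt i a) > c a
lemma9 n a a∈𝒜 i _ increase =
  swapped∈𝒜 ,
  subst₂ _<_ (sym (c≡binomialProduct a (proj₂ a∈𝒜))) (sym (c≡binomialProduct (swapAt i a) (proj₂ swapped∈𝒜)))
    (binomialProduct-swapAt i a (𝒜⇒TailBounded a a∈𝒜) increase)
  where
  swapped∈𝒜 : 𝒜 n (swapAt i a)
  swapped∈𝒜 = 𝒜-swapAt i a (<⇒≤ increase) a∈𝒜
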